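{- Let $Q$ be a mix $\star$-autonomous quantale and let $d\ge 2$ be an integer. If $f\in Q^{\langle d\rangle}$ is closed, then its interior $\mathring{f}$ is closed. Consequently, the set of clopen tuples of $Q^{\langle d\rangle}$, ordered pointwise, is a lattice.
   Context: A $\star$-autonomous quantale is a tuple $\langle Q,1,\otimes,0,\oplus,(-)^\star\rangle$ where $Q$ is a complete lattice, $(1,\otimes)$ is a monoid structure on $Q$ with $\otimes$ distributing over arbitrary joins in each variable, $(-)^\star:Q\to Q$ is an order-reversing involution, $0=1^\star$ and $f\oplus g=(g^\star\otimes f^\star)^\star$, and for all $f,g,h\in Q$: $f\otimes g\le h$ iff $f\le h\oplus g^\star$ iff $g\le f^\star\oplus h$. It is a mix $\star$-autonomous quantale if moreover $\alpha\otimes\beta\le\alpha\oplus\beta$ for all $\alpha,\beta\in Q$. Let $\langle d\rangle=\{(i,j)\mid 1\le i<j\le d\}$ and $Q^{\langle d\rangle}=\prod_{(i,j)\in\langle d\rangle}Q$ with the pointwise order. A tuple $f=(f_{i,j})$ is closed if $f_{i,j}\otimes f_{j,k}\le f_{i,k}$ for all $1\le i<j<k\le d$, open if $f_{i,k}\le f_{i,j}\oplus f_{j,k}$ for all $1\le i<j<k\le d$, and clopen if both. The interior of $f$ is the tuple $\mathring{f}$ given by $\mathring{f}_{i,j}=\bigwedge f_{i,\ell_1}\oplus f_{\ell_1,\ell_2}\oplus\cdots\oplus f_{\ell_{k-1},j}$, the meet ranging over all sequences $i=\ell_0<\ell_1<\dots<\ell_k=j$ of integers in $\{1,\dots,d\}$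 ($k\ge1$); it is the greatest open tuple below $f$. -}

module Defs where

open import Level using (Level; _⊔_; Lift; lift) renaming (suc to lsuc)
open import Data.Nat using (ℕ)
open import Data.Fin using (Fin; _<_)
open import Data.Fin.Properties using (<-trans)
open import Data.Product using (Σ; _×_; proj₁)
open import Function.Bundles using (_⇔_)
open import Relation.Binary.Structures using (IsPartialOrder)
open import Relation.Binary.Core using (Rel)

-- Completeness: arbitrary joins and meets of families indexed by any
-- type of level c (this includes all subsets of the carrier).

record MixStarQuantale (c ℓ : Level) : Set (lsuc (c ⊔ ℓ)) where
  infixl 7 _⊗_
  infixl 6 _⊕_
  infix 4 _≈_ _≤_
  infix 9 _⋆
  field
    Carrier        : Set c
    _≈_            : Rel Carrier ℓ
    _≤_            : Rel Carrier ℓ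
    isPartialOrder : IsPartialOrder _≈_ _≤_
    ⋁        : {I : Set c} → (I → Carrier) → Carrier
    ⋁-upper  : {I : Set c} (x : I → Carrier) (i : I) → x i ≤ ⋁ x
    ⋁-least  : {I : Set c} (x : I → Carrier) (y : Carrier) →
               (∀ i → x i ≤ y) → ⋁ x ≤ y
    ⋀        : {I : Set c} → (I → Carrier) → Carrier
    ⋀-lower  : {I : Set c} (x : I → Carrier) (i : I) → ⋀ x ≤ x i
    ⋀-greatest : {I : Set c} (x : I → Carrier) (y : Carrier) →
               (∀ i → y ≤ x i) → y ≤ ⋀ x
    1#       : Carrier
    _⊗_      : Carrier → Carrier → Carrier
    ⊗-cong   : ∀ {x y u v} → x ≈ y → u ≈ v → x ⊗ u ≈ y ⊗ v
    ⊗-assoc  : ∀ x y z → (x ⊗ y) ⊗ z ≈ x ⊗ (y ⊗ z)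
    ⊗-identityˡ : ∀ x → 1# ⊗ x ≈ x
    ⊗-identityʳ : ∀ x → x ⊗ 1# ≈ x
    ⊗-distribˡ-⋁ : ∀ {I : Set c} (x : Carrier) (y : I → Carrier) →
                   x ⊗ ⋁ y ≈ ⋁ (λ i → x ⊗ y i)
    ⊗-distribʳ-⋁ : ∀ {I : Set c} (y : I → Carrier) (x : Carrier) →
                   ⋁ y ⊗ x ≈ ⋁ (λ i → y i ⊗ x)
    _⋆       : Carrier → Carrier
    ⋆-antitone : ∀ {x y} → x ≤ y → y ⋆ ≤ x ⋆
    ⋆-involutive : ∀ x → (x ⋆) ⋆ ≈ x

  0# : Carrier
  0# = 1# ⋆

  _⊕_ : Carrier → Carrier → Carrier
  f ⊕ g = ((g ⋆) ⊗ (f ⋆)) ⋆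

  field
    adjointʳ : ∀ f g h → (f ⊗ g ≤ h) ⇔ (f ≤ h ⊕ g ⋆)
    adjointˡ : ∀ f g h → (f ⊗ g ≤ h) ⇔ (g ≤ f ⋆ ⊕ h)
    mix      : ∀ α β → α ⊗ β ≤ α ⊕ β

-- Tuples in Q^⟨d⟩, indexed by pairs i < j of elements of Fin d
-- (Fin d = {0,…,d-1} plays the role of {1,…,d}).

module Tuples {c ℓ : Level} (Q : MixStarQuantale c ℓ) (d : ℕ) where
  open MixStarQuantale Q

  Tuple : Set c
  Tuple = (i j : Fin d) → i < j → Carrier

  _≤ₜ_ : Tuple → Tuple → Set ℓ
  f ≤ₜ g = ∀ i j (p : i < j) → f i j p ≤ g i j p

  _≈ₜ_ : Tuple → Tuple → Set ℓ
  f ≈ₜ g = ∀ i j (p : i < j) → f i j p ≈ g i j p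

  Closed : Tuple → Set ℓ
  Closed f = ∀ i j k (p : i < j) (q : j < k) →
             f i j p ⊗ f j k q ≤ f i k (<-trans p q)

  Open : Tuple → Set ℓ
  Open f = ∀ i j k (p : i < j) (q : j < k) →
           f i k (<-trans p q) ≤ f i j p ⊕ f j k q

  Clopen : Tuple → Set ℓ
  Clopen f = Closed f × Open f

  data Chain : Fin d → Fin d → Set where
    step : ∀ {i j} → i < j → Chain i j
    _∷_  : ∀ {i l j} → i < l → Chain l j → Chain i j

  chainSum : Tuple → ∀ {i j} → Chain i j → Carrier
  chainSum f {i} {j} (step p) = f i j p
  chainSum f {i} (_∷_ {l = l} p ch) = f i l p ⊕ chainSum f ch

  interior : Tuple → Tuple
  interior f i j _ = ⋀ {I = Lift c (Chain i j)} (λ ch → chainSum f (Level.lower ch))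

  ClopenTuple : Set (c ⊔ ℓ)
  ClopenTuple = Σ Tuple Clopen

  _≈ᶜ_ : Rel ClopenTuple ℓ
  f ≈ᶜ g = proj₁ f ≈ₜ proj₁ g

  _≤ᶜ_ : Rel ClopenTuple ℓ
  f ≤ᶜ g = proj₁ f ≤ₜ proj₁ g

module Submission where

-- The heart of the proof is a chain-splitting argument.  Call x a lower
-- bound of the chains from i to j if x ≤ f_{i,ℓ₁} ⊕ … ⊕ f_{ℓ_{k-1},j} for
-- every chain i < ℓ₁ < … < j.  If f is closed, x bounds the chains i ⇝ j
-- and y bounds the chains j ⇝ k, then x ⊗ y bounds the chains i ⇝ k: by
-- induction on the chain, peel off its first summand f_{i,l} by residuation
-- and compare l with j; when l = j the mix law x ⊗ y ≤ x ⊕ y concludes.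
-- Applied to the interior (which bounds all chains) this gives closedness.
--
-- Clopenness is self-dual, so joins of clopen tuples are meets computed in
-- the dual quantale, and the lattice structure follows.

open import Level using (Level; Lift; lift; lower)
open import Data.Bool using (Bool; true; false)
open import Data.Nat using (ℕ) renaming (_≤_ to _≤ℕ_)
open import Data.Fin using (Fin; _<_)
open import Data.Fin.Properties using (<-trans; <-cmp; <-irrelevant)
open import Data.Product using (Σ; _×_; _,_; proj₁)
open import Function using (flip)
open import Function.Bundles using (mk⇔; Equivalence)
open import Relation.Binary.Bundles using (Poset)
open import Relation.Binary.Structures using (IsPartialOrder; IsEquivalence)
open import Relation.Binary.Definitions using (tri<; tri≈; tri>)
open import Relation.Binary.Lattice.Definitions using (Supremum; Infimum)
open import Relation.Binary.Lattice.Structures using (IsLattice)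
open import Relation.Binary.PropositionalEquality using (refl)
import Relation.Binary.Construct.Flip.EqAndOrd as Flip
import Relation.Binary.Construct.On as On
import Relation.Binary.Reasoning.PartialOrder as PosetReasoning

open import Defs

module Laws {c ℓ : Level} (Q : MixStarQuantale c ℓ) where
  open MixStarQuantale Q
  open IsPartialOrder isPartialOrder public
    using (antisym; ≤-respˡ-≈; ≤-respʳ-≈)
    renaming (refl to ≤-refl; trans to ≤-trans; reflexive to ≤-reflexive)
  open IsEquivalence (IsPartialOrder.isEquivalence isPartialOrder) public
    renaming (refl to ≈-refl; sym to ≈-sym; trans to ≈-trans)

  poset : Poset c ℓ ℓ
  poset = record { isPartialOrder = isPartialOrder }

  ⋆-cong : ∀ {x y} → x ≈ y → x ⋆ ≈ y ⋆
  ⋆-cong e = antisym (⋆-antitone (≤-reflexive (≈-sym e))) (⋆-antitone (≤-reflexive e))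

  ⊕-cong : ∀ {x y u v} → x ≈ y → u ≈ v → x ⊕ u ≈ y ⊕ v
  ⊕-cong e e′ = ⋆-cong (⊗-cong (⋆-cong e′) (⋆-cong e))

  ⊕ˡ-residual : ∀ {x a h} → x ≤ a ⊕ h → a ⋆ ⊗ x ≤ h
  ⊕ˡ-residual {x} {a} {h} p = Equivalence.from (adjointˡ (a ⋆) x h)
    (≤-respʳ-≈ (⊕-cong (≈-sym (⋆-involutive a)) ≈-refl) p)

  ⊕ˡ-residual⁻¹ : ∀ {x a h} → a ⋆ ⊗ x ≤ h → x ≤ a ⊕ h
  ⊕ˡ-residual⁻¹ {x} {a} {h} p =
    ≤-respʳ-≈ (⊕-cong (⋆-involutive a) ≈-refl) (Equivalence.to (adjointˡ (a ⋆) x h) p)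

  ⊕ʳ-residual : ∀ {x a h} → x ≤ h ⊕ a → x ⊗ a ⋆ ≤ h
  ⊕ʳ-residual {x} {a} {h} p = Equivalence.from (adjointʳ x (a ⋆) h)
    (≤-respʳ-≈ (⊕-cong ≈-refl (≈-sym (⋆-involutive a))) p)

  ⊕ʳ-residual⁻¹ : ∀ {x a h} → x ⊗ a ⋆ ≤ h → x ≤ h ⊕ a
  ⊕ʳ-residual⁻¹ {x} {a} {h} p =
    ≤-respʳ-≈ (⊕-cong ≈-refl (⋆-involutive a)) (Equivalence.to (adjointʳ x (a ⋆) h) p)

  ⊕-introˡ : ∀ {a x y h} → (a ⋆ ⊗ x) ⊗ y ≤ h → x ⊗ y ≤ a ⊕ h
  ⊕-introˡ p = ⊕ˡ-residual⁻¹ (≤-respˡ-≈ (⊗-assoc _ _ _) p)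

  ⊗-monoˡ : ∀ {x y} g → x ≤ y → x ⊗ g ≤ y ⊗ g
  ⊗-monoˡ {x} {y} g p = Equivalence.from (adjointʳ x g (y ⊗ g))
    (≤-trans p (Equivalence.to (adjointʳ y g (y ⊗ g)) ≤-refl))

  ⊗-monoʳ : ∀ {x y} g → x ≤ y → g ⊗ x ≤ g ⊗ y
  ⊗-monoʳ {x} {y} g p = Equivalence.from (adjointˡ g x (g ⊗ y))
    (≤-trans p (Equivalence.to (adjointˡ g y (g ⊗ y)) ≤-refl))

  ⊗-mono : ∀ {x y u v} → x ≤ y → u ≤ v → x ⊗ u ≤ y ⊗ v
  ⊗-mono {y = y} p q = ≤-trans (⊗-monoˡ _ p) (⊗-monoʳ y q)

  ⊕-mono : ∀ {x y u v} → x ≤ y → u ≤ v → x ⊕ u ≤ y ⊕ v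
  ⊕-mono p q = ⋆-antitone (⊗-mono (⋆-antitone q) (⋆-antitone p))

  ⊗-deMorgan : ∀ a b → a ⊗ b ≈ (b ⋆ ⊕ a ⋆) ⋆
  ⊗-deMorgan a b = ≈-sym (≈-trans (⋆-involutive _) (⊗-cong (⋆-involutive a) (⋆-involutive b)))

  ⊕-assoc : ∀ x y z → (x ⊕ y) ⊕ z ≈ x ⊕ (y ⊕ z)
  ⊕-assoc x y z = ⋆-cong (≈-trans (⊗-cong ≈-refl (⋆-involutive _))
    (≈-trans (≈-sym (⊗-assoc _ _ _)) (⊗-cong (≈-sym (⋆-involutive _)) ≈-refl)))

  ⊕-identityˡ : ∀ x → 0# ⊕ x ≈ x
  ⊕-identityˡ x =
    ≈-trans (⋆-cong (≈-trans (⊗-cong ≈-refl (⋆-involutive 1#)) (⊗-identityʳ _))) (⋆-involutive x)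

  ⊕-identityʳ : ∀ x → x ⊕ 0# ≈ x
  ⊕-identityʳ x =
    ≈-trans (⋆-cong (≈-trans (⊗-cong (⋆-involutive 1#) ≈-refl) (⊗-identityˡ _))) (⋆-involutive x)

  ⊕-distribˡ-⋀ : ∀ {I : Set c} x (y : I → Carrier) → x ⊕ ⋀ y ≈ ⋀ (λ i → x ⊕ y i)
  ⊕-distribˡ-⋀ x y = antisym
    (⋀-greatest _ _ (λ i → ⊕-mono ≤-refl (⋀-lower y i)))
    (⊕ˡ-residual⁻¹ (⋀-greatest y _ λ i → ⊕ˡ-residual (⋀-lower _ i)))

  ⊕-distribʳ-⋀ : ∀ {I : Set c} (y : I → Carrier) x → ⋀ y ⊕ x ≈ ⋀ (λ i → y i ⊕ x)
  ⊕-distribʳ-⋀ y x = antisym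
    (⋀-greatest _ _ (λ i → ⊕-mono (⋀-lower y i) ≤-refl))
    (⊕ʳ-residual⁻¹ (⋀-greatest y _ λ i → ⊕ʳ-residual (⋀-lower _ i)))

  ⋀⊕⋀-greatest : ∀ {I J : Set c} (u : I → Carrier) (v : J → Carrier) z →
                 (∀ i j → z ≤ u i ⊕ v j) → z ≤ ⋀ u ⊕ ⋀ v
  ⋀⊕⋀-greatest u v z bound = ⊕ʳ-residual⁻¹ (⋀-greatest u _ λ i →
    ⊕ʳ-residual (≤-respʳ-≈ (≈-sym (⊕-distribˡ-⋀ (u i) v)) (⋀-greatest _ _ (bound i))))

  infixr 7 _∧_
  _∧_ : Carrier → Carrier → Carrier
  a ∧ b = ⋀ {I = Lift c Bool} λ { (lift true) → a ; (lift false) → b }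

  ∧-lowerˡ : ∀ {a b} → a ∧ b ≤ a
  ∧-lowerˡ = ⋀-lower _ (lift true)

  ∧-lowerʳ : ∀ {a b} → a ∧ b ≤ b
  ∧-lowerʳ = ⋀-lower _ (lift false)

  ∧-greatest : ∀ {a b z} → z ≤ a → z ≤ b → z ≤ a ∧ b
  ∧-greatest p q = ⋀-greatest _ _ λ { (lift true) → p ; (lift false) → q }

dual : {c ℓ : Level} → MixStarQuantale c ℓ → MixStarQuantale c ℓ
dual Q = record
  { Carrier        = Carrier
  ; _≈_            = _≈_
  ; _≤_            = flip _≤_
  ; isPartialOrder = Flip.isPartialOrder isPartialOrder
  ; ⋁              = ⋀
  ; ⋁-upper        = ⋀-lower
  ; ⋁-least        = ⋀-greatest
  ; ⋀              = ⋁
  ; ⋀-lower        = ⋁-upper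
  ; ⋀-greatest     = ⋁-least
  ; 1#             = 0#
  ; _⊗_            = _⊕_
  ; ⊗-cong         = ⊕-cong
  ; ⊗-assoc        = ⊕-assoc
  ; ⊗-identityˡ    = ⊕-identityˡ
  ; ⊗-identityʳ    = ⊕-identityʳ
  ; ⊗-distribˡ-⋁   = ⊕-distribˡ-⋀
  ; ⊗-distribʳ-⋁   = ⊕-distribʳ-⋀
  ; _⋆             = _⋆
  ; ⋆-antitone     = ⋆-antitone
  ; ⋆-involutive   = ⋆-involutive
  ; adjointʳ       = λ f g h → mk⇔
      (λ p → ≤-respˡ-≈ (⊗-deMorgan h (g ⋆)) (⊕ʳ-residual p))
      (λ p → ⊕ʳ-residual⁻¹ (≤-respˡ-≈ (≈-sym (⊗-deMorgan h (g ⋆))) p))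
  ; adjointˡ       = λ f g h → mk⇔
      (λ p → ≤-respˡ-≈ (⊗-deMorgan (f ⋆) h) (⊕ˡ-residual p))
      (λ p → ⊕ˡ-residual⁻¹ (≤-respˡ-≈ (≈-sym (⊗-deMorgan (f ⋆) h)) p))
  ; mix            = λ α β → ≤-respˡ-≈ (⊗-deMorgan α β) (mix α β)
  }
  where open MixStarQuantale Q
        open Laws Q

module Interior {c ℓ : Level} (Q : MixStarQuantale c ℓ) (d : ℕ) where
  open MixStarQuantale Q
  open Laws Q
  open Tuples Q d
  open PosetReasoning poset

  tuple-irrelevant : (f : Tuple) {i j : Fin d} (p q : i < j) → f i j p ≈ f i j q
  tuple-irrelevant f p q rewrite <-irrelevant p q = ≈-refl

  chain-< : ∀ {i j} → Chain i j → i < j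
  chain-< (step p) = p
  chain-< (p ∷ C) = <-trans p (chain-< C)

  _++_ : ∀ {i j k} → Chain i j → Chain j k → Chain i k
  step p ++ E = p ∷ E
  (p ∷ D) ++ E = p ∷ (D ++ E)

  chainSum-++ : (f : Tuple) {i j k : Fin d} (D : Chain i j) (E : Chain j k) →
                chainSum f (D ++ E) ≤ chainSum f D ⊕ chainSum f E
  chainSum-++ f (step p) E = ≤-refl
  chainSum-++ f (p ∷ D) E =
    ≤-trans (⊕-mono ≤-refl (chainSum-++ f D E)) (≤-reflexive (≈-sym (⊕-assoc _ _ _)))

  BoundsChains : Tuple → Carrier → Fin d → Fin d → Set ℓ
  BoundsChains f x i j = (C : Chain i j) → x ≤ chainSum f C

  interior-bounds : (f : Tuple) {i j : Fin d} (p : i < j) → BoundsChains f (interior f i j p) i j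
  interior-bounds f p C = ⋀-lower _ (lift C)

  interior-greatest : (f : Tuple) {i j : Fin d} (p : i < j) {x : Carrier} →
                      BoundsChains f x i j → x ≤ interior f i j p
  interior-greatest f p bound = ⋀-greatest _ _ λ C → bound (lower C)

  interior-deflationary : (f : Tuple) → interior f ≤ₜ f
  interior-deflationary f i j p = interior-bounds f p (step p)

  -- An open tuple below f bounds every chain sum of f: use openness to
  -- split its value along the chain.
  open-bounds-chains : (f g : Tuple) → Open g → g ≤ₜ f →
                       ∀ {i j} (p : i < j) → BoundsChains f (g i j p) i j
  open-bounds-chains f g open-g g≤f p (step q) =
    ≤-trans (≤-reflexive (tuple-irrelevant g p q)) (g≤f _ _ q)
  open-bounds-chains f g open-g g≤f p (q ∷ C) = begin
    g _ _ p                         ≈⟨ tuple-irrelevant g p _ ⟩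
    g _ _ (<-trans q (chain-< C))   ≤⟨ open-g _ _ _ q (chain-< C) ⟩
    g _ _ q ⊕ g _ _ (chain-< C)     ≤⟨ ⊕-mono (g≤f _ _ q) (open-bounds-chains f g open-g g≤f _ C) ⟩
    f _ _ q ⊕ chainSum f C          ∎

  interior-greatest-open : (f g : Tuple) → Open g → g ≤ₜ f → g ≤ₜ interior f
  interior-greatest-open f g open-g g≤f i j p =
    interior-greatest f p (open-bounds-chains f g open-g g≤f p)

  interior-open : (f : Tuple) → Open (interior f)
  interior-open f i j k p q = ⋀⊕⋀-greatest _ _ _ λ D E →
    ≤-trans (interior-bounds f (<-trans p q) (lower D ++ lower E)) (chainSum-++ f (lower D) (lower E))

  module _ (f : Tuple) (closed : Closed f) where

    closed-residual : ∀ {i j l} (p : i < j) (q : j < l) (r : i < l) {x : Carrier} →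
                      x ≤ f i j p → f i l r ⋆ ⊗ x ≤ f j l q ⋆
    closed-residual p q r {x} x≤f = ⊕ˡ-residual (⊕ʳ-residual⁻¹ (begin
      x ⊗ f _ _ q ⋆ ⋆     ≤⟨ ⊗-mono x≤f (≤-reflexive (⋆-involutive _)) ⟩
      f _ _ p ⊗ f _ _ q   ≤⟨ closed _ _ _ p q ⟩
      f _ _ (<-trans p q) ≈⟨ tuple-irrelevant f _ r ⟩
      f _ _ r             ∎))

    -- Chain splitting: bounds of the chains i ⇝ j and j ⇝ k multiply to a
    -- bound of the chains i ⇝ k.  Induction on the chain, comparing its
    -- first step i < l with j.
    product-bounds-chains : ∀ {i j k} (p : i < j) (q : j < k) {x y : Carrier} →
      BoundsChains f x i j → BoundsChains f y j k → BoundsChains f (x ⊗ y) i k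
    product-bounds-chains p q {x} {y} bx by (step r) = begin
      x ⊗ y               ≤⟨ ⊗-mono (bx (step p)) (by (step q)) ⟩
      f _ _ p ⊗ f _ _ q   ≤⟨ closed _ _ _ p q ⟩
      f _ _ (<-trans p q) ≈⟨ tuple-irrelevant f _ r ⟩
      f _ _ r             ∎
    product-bounds-chains {j = j} p q {x} {y} bx by (_∷_ {l = l} r C) with <-cmp j l
    ... | tri< j<l _ _ = ⊕-introˡ (begin
      (f _ _ r ⋆ ⊗ x) ⊗ y ≤⟨ ⊗-monoˡ y (closed-residual p j<l r (bx (step p))) ⟩
      f _ _ j<l ⋆ ⊗ y     ≤⟨ ⊕ˡ-residual (by (j<l ∷ C)) ⟩
      chainSum f C        ∎)
    ... | tri≈ _ refl _ = begin
      x ⊗ y                  ≤⟨ mix x y ⟩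
      x ⊕ y                  ≤⟨ ⊕-mono (bx (step p)) (by C) ⟩
      f _ _ p ⊕ chainSum f C ≈⟨ ⊕-cong (tuple-irrelevant f p r) ≈-refl ⟩
      f _ _ r ⊕ chainSum f C ∎
    ... | tri> _ _ l<j = ⊕-introˡ
      (product-bounds-chains l<j q (λ D → ⊕ˡ-residual (bx (r ∷ D))) by C)

  interior-closed : (f : Tuple) → Closed f → Closed (interior f)
  interior-closed f closed i j k p q = interior-greatest f (<-trans p q)
    (product-bounds-chains f closed p q (interior-bounds f p) (interior-bounds f q))

module ClopenMeet {c ℓ : Level} (Q : MixStarQuantale c ℓ) (d : ℕ) where
  open MixStarQuantale Q
  open Laws Q
  open Tuples Q d
  open Interior Q d

  _∧ₜ_ : Tuple → Tuple → Tuple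
  (g ∧ₜ h) i j p = g i j p ∧ h i j p

  ∧ₜ-closed : (g h : Tuple) → Closed g → Closed h → Closed (g ∧ₜ h)
  ∧ₜ-closed g h closed-g closed-h i j k p q = ∧-greatest
    (≤-trans (⊗-mono ∧-lowerˡ ∧-lowerˡ) (closed-g i j k p q))
    (≤-trans (⊗-mono ∧-lowerʳ ∧-lowerʳ) (closed-h i j k p q))

  _∧ᶜ_ : ClopenTuple → ClopenTuple → ClopenTuple
  (g , closed-g , _) ∧ᶜ (h , closed-h , _) =
    interior (g ∧ₜ h) , interior-closed _ (∧ₜ-closed g h closed-g closed-h) , interior-open _

  ∧ᶜ-infimum : Infimum _≤ᶜ_ _∧ᶜ_
  ∧ᶜ-infimum (g , _) (h , _) =
      (λ i j p → ≤-trans (interior-deflationary _ i j p) ∧-lowerˡ)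
    , (λ i j p → ≤-trans (interior-deflationary _ i j p) ∧-lowerʳ)
    , λ { (k , _ , open-k) k≤g k≤h → interior-greatest-open _ k open-k
            (λ i j p → ∧-greatest (k≤g i j p) (k≤h i j p)) }

module ClopenLattice {c ℓ : Level} (Q : MixStarQuantale c ℓ) (d : ℕ) where
  open MixStarQuantale Q
  open Laws Q
  open Tuples Q d
  open ClopenMeet Q d using (_∧ᶜ_; ∧ᶜ-infimum)
  module Dual = Tuples (dual Q) d
  module DualMeet = ClopenMeet (dual Q) d

  -- Closed for Q is open for the dual and vice versa (the other half,
  -- open for Q is closed for the dual, holds by definition).
  toDual : ClopenTuple → Dual.ClopenTuple
  toDual (f , closed , open-f) =
    f , open-f , λ i j k p q → ≤-respˡ-≈ (⊗-deMorgan _ _) (closed i j k p q)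

  fromDual : Dual.ClopenTuple → ClopenTuple
  fromDual (f , open-f , dual-open-f) =
    f , (λ i j k p q → ≤-respˡ-≈ (≈-sym (⊗-deMorgan _ _)) (dual-open-f i j k p q)) , open-f

  _∨ᶜ_ : ClopenTuple → ClopenTuple → ClopenTuple
  g ∨ᶜ h = fromDual (toDual g DualMeet.∧ᶜ toDual h)

  ∨ᶜ-supremum : Supremum _≤ᶜ_ _∨ᶜ_
  ∨ᶜ-supremum g h with DualMeet.∧ᶜ-infimum (toDual g) (toDual h)
  ... | lowerˡ , lowerʳ , greatest = lowerˡ , lowerʳ , λ k → greatest (toDual k)

  ≤ₜ-isPartialOrder : IsPartialOrder _≈ₜ_ _≤ₜ_
  ≤ₜ-isPartialOrder = record
    { isPreorder = record
      { isEquivalence = record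
        { refl  = λ i j p → ≈-refl
        ; sym   = λ e i j p → ≈-sym (e i j p)
        ; trans = λ e e′ i j p → ≈-trans (e i j p) (e′ i j p) }
      ; reflexive = λ e i j p → ≤-reflexive (e i j p)
      ; trans     = λ e e′ i j p → ≤-trans (e i j p) (e′ i j p) }
    ; antisym = λ e e′ i j p → antisym (e i j p) (e′ i j p) }

  clopen-isLattice : IsLattice _≈ᶜ_ _≤ᶜ_ _∨ᶜ_ _∧ᶜ_
  clopen-isLattice = record
    { isPartialOrder = On.isPartialOrder proj₁ ≤ₜ-isPartialOrder
    ; supremum       = ∨ᶜ-supremum
    ; infimum        = ∧ᶜ-infimum
    }

theorem1 : {c ℓ : Level} (Q : MixStarQuantale c ℓ) (d : ℕ) → 2 ≤ℕ d →
    let open Tuples Q d in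
    ((f : Tuple) → Closed f → Closed (interior f))
    × Σ (ClopenTuple → ClopenTuple → ClopenTuple) (λ _∨_ →
        Σ (ClopenTuple → ClopenTuple → ClopenTuple) (λ _∧_ →
          IsLattice _≈ᶜ_ _≤ᶜ_ _∨_ _∧_))
theorem1 Q d _ =
    Interior.interior-closed Q d
  , ClopenLattice._∨ᶜ_ Q d
  , ClopenMeet._∧ᶜ_ Q d
  , ClopenLattice.clopen-isLattice Q d
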